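{- Let $f:\mathbb{Z}_{\ge0}\to\mathbb{Z}_{\ge0}$ be nondecreasing with $G_f(\{y,z\})=y\oplus z$ for all $y,z\in\mathbb{Z}_{\ge0}$ with $y\le f(z)$. Let $y,z,y'\in\mathbb{Z}_{\ge0}$ with $y=f(z)$, $y'\le f(z+1)$ and $y<y'$. Then $G_f(\{y,z+1\})<G_f(\{y',z+1\})$.
   Context: $\oplus$ denotes nim-sum (bitwise XOR). Positions of the chocolate bar game $CB(f,y,z)$ are pairs $\{y,z\}$ with $y\le f(z)$ (bar with $z+1$ columns, column 0 bitter, column $i$ of height $\min(f(i),y)+1$). Moves: $move_f(\{y,z\})=\{\{v,z\}:v<y\}\cup\{\{\min(y,f(w)),w\}:w<z\}$. Grundy number: $G_f(\{y,z\})=\mathrm{mex}\{G_f(p):p\in move_f(\{y,z\})\}$, mex being the least nonnegative integer not in the set. -}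

module Defs where

open import Data.Nat using (ℕ; zero; suc; _+_; _*_; _≤_; _⊓_; _≟_)
open import Data.Nat.DivMod using (_/_; _%_)
open import Data.List using (List; []; _∷_; _++_; length)
open import Data.List.Membership.DecPropositional _≟_ using (_∈?_)
open import Relation.Nullary using (yes; no)

-- Nim-sum (bitwise XOR) on ℕ, by binary recursion.
-- The fuel argument (a + b) always exceeds the number of binary digits
-- of a and b, so the result is the true bitwise XOR.
xorAux : ℕ → ℕ → ℕ → ℕ
xorAux zero    a b = 0
xorAux (suc k) a b = ((a % 2 + b % 2) % 2) + 2 * xorAux k (a / 2) (b / 2)

infixl 6 _⊕_
_⊕_ : ℕ → ℕ → ℕ
a ⊕ b = xorAux (a + b) a b

-- mex: least natural number not occurring in the list.
-- (It is at most the length of the list, so a search of length+1 steps suffices.)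
mexAux : ℕ → ℕ → List ℕ → ℕ
mexAux zero    n l = n
mexAux (suc k) n l with n ∈? l
... | yes _ = mexAux k (suc n) l
... | no  _ = n

mex : List ℕ → ℕ
mex l = mexAux (length l) 0 l

Nondecreasing : (ℕ → ℕ) → Set
Nondecreasing f = ∀ {a b} → a ≤ b → f a ≤ f b

-- Grundy numbers of the chocolate bar game CB(f,y,z).
-- grundy f y z = G_f({y,z}) = mex of the Grundy values of move_f({y,z}):
--   {v,z} for v < y            (rowVals)
--   {min(y, f w), w} for w < z (colVals)
mutual
  grundy : (ℕ → ℕ) → ℕ → ℕ → ℕ
  grundy f y z = mex (rowVals f y z ++ colVals f y z)

  rowVals : (ℕ → ℕ) → ℕ → ℕ → List ℕ
  rowVals f zero    z = []
  rowVals f (suc y) z = grundy f y z ∷ rowVals f y z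

  colVals : (ℕ → ℕ) → ℕ → ℕ → List ℕ
  colVals f y zero    = []
  colVals f y (suc z) = grundy f (y ⊓ f z) z ∷ colVals f y z

module Submission where

-- A row move from {y′, z+1} can reach {y, z+1}, and every option of {y, z+1} is also an
-- option of {y′, z+1}: row moves trivially, and a column move to w ≤ z lands on
-- {min(y, f w), w} = {f w, w} = {min(y′, f w), w} because f w ≤ f z = y < y′.
-- A mex that is an element of a superset is strictly below the superset's mex.

open import Defs
open import Data.Nat using (ℕ; suc; zero; _≤_; _<_; _+_; _⊓_; _≟_; z≤n; s≤s⁻¹)
open import Data.Nat.Properties
open import Data.List using (List; _∷_; _++_; length; filter)
open import Data.List.Membership.Propositional using (_∈_; _∉_)
open import Data.List.Membership.Propositional.Properties using (∈-filter⁺)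
open import Data.List.Membership.DecPropositional _≟_ using (_∈?_)
open import Data.List.Relation.Binary.Subset.Propositional using (_⊆_)
open import Data.List.Relation.Binary.Subset.Propositional.Properties
  using (++⁺; ⊆-reflexive; xs⊆xs++ys)
open import Data.List.Relation.Unary.Any as Any using (here; there)
open import Data.List.Properties using (filter-notAll)
open import Data.Sum using (inj₁; inj₂)
open import Function using (id; _∘_)
open import Relation.Binary.PropositionalEquality using (_≡_; refl; sym; trans; cong; cong₂; subst)
open import Relation.Nullary using (yes; no; ¬?; contradiction)
open import Relation.Binary using (tri<; tri≈; tri>)

InitialSegment : ℕ → List ℕ → Set
InitialSegment n l = ∀ {m} → m < n → m ∈ l

initialSegment-suc : ∀ {n l} → InitialSegment n l → n ∈ l → InitialSegment (suc n) l
initialSegment-suc seg n∈l m<1+n with m≤n⇒m<n∨m≡n (s≤s⁻¹ m<1+n)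
... | inj₁ m<n  = seg m<n
... | inj₂ refl = n∈l

initialSegment⇒≤length : ∀ n l → InitialSegment n l → n ≤ length l
initialSegment⇒≤length zero    l seg = z≤n
initialSegment⇒≤length (suc n) l seg =
  ≤-<-trans (initialSegment⇒≤length n l′ seg′)
            (filter-notAll ≢n? l (Any.map (λ n≡x x≢n → x≢n (sym n≡x)) (seg ≤-refl)))
  where
  ≢n? = λ x → ¬? (x ≟ n)
  l′  = filter ≢n? l
  seg′ : InitialSegment n l′
  seg′ m<n = ∈-filter⁺ ≢n? (seg (m<n⇒m<1+n m<n)) (<⇒≢ m<n)

mexAux-∉ : ∀ k n l → InitialSegment n l → length l ≤ n + k → mexAux k n l ∉ l
mexAux-∉ zero n l seg len n∈l =
  <-irrefl refl (≤-trans (initialSegment⇒≤length (suc n) l (initialSegment-suc seg n∈l))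
                         (subst (length l ≤_) (+-identityʳ n) len))
mexAux-∉ (suc k) n l seg len with n ∈? l
... | yes n∈l = mexAux-∉ k (suc n) l (initialSegment-suc seg n∈l) (subst (length l ≤_) (+-suc n k) len)
... | no  n∉l = n∉l

mexAux-initialSegment : ∀ k n l → InitialSegment n l → InitialSegment (mexAux k n l) l
mexAux-initialSegment zero    n l seg = seg
mexAux-initialSegment (suc k) n l seg with n ∈? l
... | yes n∈l = mexAux-initialSegment k (suc n) l (initialSegment-suc seg n∈l)
... | no  _   = seg

mex-∉ : ∀ l → mex l ∉ l
mex-∉ l = mexAux-∉ (length l) 0 l (λ ()) ≤-refl

mex-initialSegment : ∀ l → InitialSegment (mex l) l
mex-initialSegment l = mexAux-initialSegment (length l) 0 l (λ ())

mex-<-mex : ∀ {xs ys} → xs ⊆ ys → mex xs ∈ ys → mex xs < mex ys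
mex-<-mex {xs} {ys} xs⊆ys mexxs∈ys with <-cmp (mex xs) (mex ys)
... | tri< lt _ _ = lt
... | tri≈ _ eq _ = contradiction (subst (_∈ ys) eq mexxs∈ys) (mex-∉ ys)
... | tri> _ _ gt = contradiction (xs⊆ys (mex-initialSegment xs gt)) (mex-∉ ys)

grundy-∈-rowVals : ∀ f {v y} z → v < y → grundy f v z ∈ rowVals f y z
grundy-∈-rowVals f {y = suc y} z v<1+y with m≤n⇒m<n∨m≡n (s≤s⁻¹ v<1+y)
... | inj₁ v<y  = there (grundy-∈-rowVals f z v<y)
... | inj₂ refl = here refl

rowVals-mono : ∀ f {y y′} z → y ≤ y′ → rowVals f y z ⊆ rowVals f y′ z
rowVals-mono f {y′ = zero}   z z≤n = id
rowVals-mono f {y′ = suc y′} z y≤1+y′ with m≤n⇒m<n∨m≡n y≤1+y′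
... | inj₁ y<1+y′ = there ∘ rowVals-mono f z (s≤s⁻¹ y<1+y′)
... | inj₂ refl   = id

colVals-cong : ∀ f {y y′} z → (∀ {w} → w < z → y ⊓ f w ≡ y′ ⊓ f w) → colVals f y z ≡ colVals f y′ z
colVals-cong f zero    eq = refl
colVals-cong f (suc z) eq =
  cong₂ _∷_ (cong (λ t → grundy f t z) (eq ≤-refl)) (colVals-cong f z (eq ∘ m<n⇒m<1+n))

options : (ℕ → ℕ) → ℕ → ℕ → List ℕ
options f y z = rowVals f y z ++ colVals f y z

options-mono : ∀ f {y y′} z → y ≤ y′ → (∀ {w} → w < z → y ⊓ f w ≡ y′ ⊓ f w) →
               options f y z ⊆ options f y′ z
options-mono f z y≤y′ eq = ++⁺ (rowVals-mono f z y≤y′) (⊆-reflexive (colVals-cong f z eq))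

grundy-∈-options : ∀ f {v y} z → v < y → grundy f v z ∈ options f y z
grundy-∈-options f z v<y = xs⊆xs++ys _ _ (grundy-∈-rowVals f z v<y)

mainTheorem12 : (f : ℕ → ℕ) → Nondecreasing f →
    (∀ y z → y ≤ f z → grundy f y z ≡ y ⊕ z) →
    (y z y′ : ℕ) → y ≡ f z → y′ ≤ f (suc z) → y < y′ →
    grundy f y (suc z) < grundy f y′ (suc z)
mainTheorem12 f mono _ y z y′ y≡fz _ y<y′ =
  mex-<-mex (options-mono f (suc z) (<⇒≤ y<y′) same-column-move)
            (grundy-∈-options f (suc z) y<y′)
  where
  same-column-move : ∀ {w} → w < suc z → y ⊓ f w ≡ y′ ⊓ f w
  same-column-move w<1+z =
    let fw≤y = subst (f _ ≤_) (sym y≡fz) (mono (s≤s⁻¹ w<1+z))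
    in trans (m≥n⇒m⊓n≡n fw≤y) (sym (m≥n⇒m⊓n≡n (≤-trans fw≤y (<⇒≤ y<y′))))
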